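{- Over the class $\mathsf{Lin}$ of all linear orders, each of the following sets $S$ is $<$-complete (i.e., $FO+S$ defines the order $<$ between points): $\{\mathrm{ip}_0,\mathrm{ip}_1\}$, $\{\mathrm{ip}_3,\mathrm{ip}_4\}$, $\{\mathrm{ip}_0,\mathrm{ip}_3\}$, $\{\mathrm{ip}_1,\mathrm{ip}_4\}$, $\{\mathrm{ip}_1,\mathrm{ip}_2\}$, $\{\mathrm{ip}_2,\mathrm{ip}_3\}$, $\{\mathrm{ip}_1,\mathrm{ip}_3\}$, $\{\mathrm{ip}_1,\mathrm{ii}_{03}\}$, $\{\mathrm{ip}_3,\mathrm{ii}_{14}\}$, $\{\mathrm{ip}_1,\mathrm{ii}_{34}\}$, $\{\mathrm{ip}_3,\mathrm{ii}_{34}\}$, $\{\mathrm{ip}_1,\mathrm{ii}_{04},=_i\}$, $\{\mathrm{ip}_3,\mathrm{ii}_{04},=_i\}$, $\{\mathrm{ip}_1,\mathrm{ii}_{24},=_i\}$, $\{\mathrm{ip}_3,\mathrm{ii}_{24},=_i\}$, $\{\mathrm{ip}_1,\mathrm{ii}_{44},=_i\}$, $\{\mathrm{ip}_3,\mathrm{ii}_{44},=_i\}$, $\{\mathrm{ip}_1,\mathrm{ii}_{14},\mathrm{ii}_{24}\}$, $\{\mathrm{ip}_1,\mathrm{ii}_{14},\mathrm{ii}_{04}\}$, $\{\mathrm{ip}_1,\mathrm{ii}_{14},\mathrm{ii}_{44}\}$, $\{\mathrm{ip}_3,\mathrm{ii}_{24},\mathrm{ii}_{03}\}$, $\{\mathrm{ip}_3,\mathrm{ii}_{03},\mathrm{ii}_{04}\}$,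 $\{\mathrm{ip}_3,\mathrm{ii}_{03},\mathrm{ii}_{44}\}$.
   Context: Let $\mathbb D=(D,<)$ be a linear order; intervals are pairs $[a,b]$ of points with $a<b$, $\mathbb I(\mathbb D)$ the set of intervals. An interval $[a,b]$ partitions $D$ into regions $0=\{x<a\}$, $1=\{a\}$, $2=\{a<x<b\}$, $3=\{b\}$, $4=\{x>b\}$. Interval-point relations: $[a,b]\,\mathrm{ip}_k\,c$ iff $c$ lies in region $k$. Interval-interval relations: $[a,b]\,\mathrm{ii}_{kk'}\,[c,d]$ iff $c$ lies in region $k$ and $d$ in region $k'$ of $[a,b]$; in particular $\mathrm{ii}_{34}$: $b=c$; $\mathrm{ii}_{44}$: $b<c$; $\mathrm{ii}_{14}$: $a=c,b<d$; $\mathrm{ii}_{03}$: $c<a,d=b$; $\mathrm{ii}_{04}$: $c<a,b<d$; $\mathrm{ii}_{24}$: $a<c<b<d$; $=_i$ is interval equality. For a set $S$ of relations, $FO+S$ is two-sorted first-order logic without equality (sorts: points and intervals) with only relation symbols for members of $S$, interpreted on $\langle D,\mathbb I(\mathbb D)\rangle$. $S$ is $r$-complete over a class $\mathrm C$ if some $FO+S$ formula $\varphi(x,y)$ with free variables exactly $x,y$ (of the sorts of $r$'s arguments) satisfies $\varphi(x,y)\leftrightarrow r(x,y)$ for all appropriate $x,y$ in every $\langle D,\mathbb I(\mathbb D)\rangle$ with $\mathbb D\in\mathrm C$. -}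

module Defs where

open import Level using (0ℓ)
open import Data.Fin using (Fin; zero; suc)
open import Data.List using (List; []; _∷_; length)
open import Data.List.Membership.Propositional using (_∈_)
open import Data.List.Relation.Unary.Any using (index)
open import Data.List.Relation.Unary.All using (All; []; _∷_; lookup)
open import Data.Product using (Σ; _×_; _,_; proj₁; proj₂; ∃)
open import Data.Sum using (_⊎_)
open import Data.Empty using (⊥)
open import Data.Unit using (⊤)
open import Relation.Binary.PropositionalEquality using (_≡_)
open import Relation.Binary.Structures using (IsStrictTotalOrder)
open import Function.Bundles using (_⇔_)

record LinOrder : Set₁ where
  field
    D   : Set
    _<_ : D → D → Set
    isLinear : IsStrictTotalOrder _≡_ _<_

data Sort : Set where
  pt iv : Sort

data Sym : Set where
  ip  : Fin 5 → Sym
  ii  : Fin 5 → Fin 5 → Sym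
  eqi : Sym

sig : Sym → Sort × Sort
sig (ip _)   = iv , pt
sig (ii _ _) = iv , iv
sig eqi      = iv , iv

F0 F1 F2 F3 F4 : Fin 5
F0 = zero
F1 = suc zero
F2 = suc (suc zero)
F3 = suc (suc (suc zero))
F4 = suc (suc (suc (suc zero)))

ip0 ip1 ip2 ip3 ip4 : Sym
ip0 = ip F0
ip1 = ip F1
ip2 = ip F2
ip3 = ip F3
ip4 = ip F4

ii03 ii04 ii14 ii24 ii34 ii44 : Sym
ii03 = ii F0 F3
ii04 = ii F0 F4
ii14 = ii F1 F4
ii24 = ii F2 F4
ii34 = ii F3 F4
ii44 = ii F4 F4

-- Syntax of FO+S: two-sorted first-order logic without equality,
-- whose only relation symbols are the members of S.
-- Variables are typed de Bruijn indices into a context of sorts.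

Ctx : Set
Ctx = List Sort

data Formula (S : List Sym) (Γ : Ctx) : Set where
  atom : (r : Sym) → r ∈ S →
         proj₁ (sig r) ∈ Γ → proj₂ (sig r) ∈ Γ → Formula S Γ
  ⊤′ ⊥′ : Formula S Γ
  ¬′_  : Formula S Γ → Formula S Γ
  _∧′_ _∨′_ _⇒′_ : Formula S Γ → Formula S Γ → Formula S Γ
  ∀′ ∃′ : (s : Sort) → Formula S (s ∷ Γ) → Formula S Γ

data Occurs {S : List Sym} {Γ : Ctx} (i : Fin (length Γ)) : Formula S Γ → Set where
  atomˡ : ∀ {r} {m : r ∈ S} {x y} → i ≡ index x → Occurs i (atom r m x y)
  atomʳ : ∀ {r} {m : r ∈ S} {x y} → i ≡ index y → Occurs i (atom r m x y)
  neg   : ∀ {φ} → Occurs i φ → Occurs i (¬′ φ)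
  andˡ  : ∀ {φ ψ} → Occurs i φ → Occurs i (φ ∧′ ψ)
  andʳ  : ∀ {φ ψ} → Occurs i ψ → Occurs i (φ ∧′ ψ)
  orˡ   : ∀ {φ ψ} → Occurs i φ → Occurs i (φ ∨′ ψ)
  orʳ   : ∀ {φ ψ} → Occurs i ψ → Occurs i (φ ∨′ ψ)
  impˡ  : ∀ {φ ψ} → Occurs i φ → Occurs i (φ ⇒′ ψ)
  impʳ  : ∀ {φ ψ} → Occurs i ψ → Occurs i (φ ⇒′ ψ)
  all   : ∀ {s φ} → Occurs {Γ = s ∷ Γ} (suc i) φ → Occurs i (∀′ s φ)
  ex    : ∀ {s φ} → Occurs {Γ = s ∷ Γ} (suc i) φ → Occurs i (∃′ s φ)

module Semantics (L : LinOrder) where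
  open LinOrder L

  Interval : Set
  Interval = Σ (D × D) λ ab → proj₁ ab < proj₂ ab

  ⟦_⟧ₛ : Sort → Set
  ⟦ pt ⟧ₛ = D
  ⟦ iv ⟧ₛ = Interval

  Region : D → D → Fin 5 → D → Set
  Region a b zero c                            = c < a
  Region a b (suc zero) c                      = c ≡ a
  Region a b (suc (suc zero)) c                = (a < c) × (c < b)
  Region a b (suc (suc (suc zero))) c          = c ≡ b
  Region a b (suc (suc (suc (suc zero)))) c    = b < c

  ⟦_⟧ᵣ : (r : Sym) → ⟦ proj₁ (sig r) ⟧ₛ → ⟦ proj₂ (sig r) ⟧ₛ → Set
  ⟦ ip k ⟧ᵣ ((a , b) , _) c = Region a b k c
  ⟦ ii k k′ ⟧ᵣ ((a , b) , _) ((c , d) , _) = Region a b k c × Region a b k′ d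
  ⟦ eqi ⟧ᵣ ((a , b) , _) ((c , d) , _) = (a ≡ c) × (b ≡ d)

  Env : Ctx → Set
  Env Γ = All ⟦_⟧ₛ Γ

  ⟦_⟧ : ∀ {S Γ} → Formula S Γ → Env Γ → Set
  ⟦ atom r _ x y ⟧ ρ = ⟦ r ⟧ᵣ (lookup ρ x) (lookup ρ y)
  ⟦ ⊤′ ⟧ ρ = ⊤
  ⟦ ⊥′ ⟧ ρ = ⊥
  ⟦ ¬′ φ ⟧ ρ = ⟦ φ ⟧ ρ → ⊥
  ⟦ φ ∧′ ψ ⟧ ρ = ⟦ φ ⟧ ρ × ⟦ ψ ⟧ ρ
  ⟦ φ ∨′ ψ ⟧ ρ = ⟦ φ ⟧ ρ ⊎ ⟦ ψ ⟧ ρ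
  ⟦ φ ⇒′ ψ ⟧ ρ = ⟦ φ ⟧ ρ → ⟦ ψ ⟧ ρ
  ⟦ ∀′ s φ ⟧ ρ = (v : ⟦ s ⟧ₛ) → ⟦ φ ⟧ (v ∷ ρ)
  ⟦ ∃′ s φ ⟧ ρ = Σ ⟦ s ⟧ₛ λ v → ⟦ φ ⟧ (v ∷ ρ)

-- S is <-complete over the class Lin of all linear orders:
-- some FO+S formula φ(x,y), with free variables exactly x,y (both of
-- point sort; x is de Bruijn index 0, y index 1), satisfies
-- φ(x,y) ↔ x < y in every ⟨D, 𝕀(𝔻)⟩.

LtComplete : List Sym → Set₁
LtComplete S =
  Σ (Formula S (pt ∷ pt ∷ [])) λ φ →
    Occurs zero φ × Occurs (suc zero) φ ×
    ((L : LinOrder) → let open LinOrder L; open Semantics L in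
      (x y : D) → ⟦ φ ⟧ (x ∷ y ∷ []) ⇔ (x < y))

-- Every set receives an explicit formula φ(x,y) with x < y → φ(x,y); the
-- converse is obtained by trichotomy, showing that φ(x,y) refutes y ≤ x.
--
-- With interval–point relations only, φ puts x and y at the two endpoints of
-- one interval, or compares the intervals starting (ending) at x and at y.
-- With ip₁ or ip₃ and one interval–interval relation, a formula St(u,v) holds
-- when u < v and fails when v < u, and φ(x,y) is St(x,y) ∧ ¬ St(y,x).
-- For the three-symbol sets with ip₁ we split on whether y has two points
-- above it.  If it has, the interval–interval relation can place an interval
-- starting at y against one starting at x in a way that forces x < y.  If not,
-- all intervals starting at y coincide, which eqi or ¬ ii₁₄ expresses, and
-- then x < y iff x ≠ y and some interval starts at x: for y < x the intervals
-- from y to x and from y beyond x would differ.  The split is not decidable,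
-- so φ is the double negation of the disjunction; ip₃ is the mirror image.

module Submission where

open import Defs
open import Data.List using (List; []; _∷_)
open import Data.List.Relation.Unary.All using (All; []; _∷_)
open import Data.List.Relation.Unary.Any using (here; there)
open import Data.List.Membership.Propositional using (_∈_)
open import Data.Fin using (zero; suc)
open import Data.Product using (_×_; _,_; proj₁; proj₂; ∃; ∃₂)
open import Data.Sum using (_⊎_; inj₁; inj₂)
open import Data.Empty using (⊥-elim)
open import Function using (_∘_)
open import Function.Bundles using (mk⇔)
open import Relation.Nullary using (¬_; yes; no)
open import Relation.Nullary.Decidable using (¬¬-excluded-middle)
open import Relation.Binary.PropositionalEquality using (_≡_; refl; sym; trans)
open import Relation.Binary.Definitions using (tri<; tri≈; tri>)
open import Relation.Binary.Structures using (IsStrictTotalOrder)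

Γxy : Ctx
Γxy = pt ∷ pt ∷ []

ΓKJxy : Ctx
ΓKJxy = iv ∷ iv ∷ Γxy

v0 : ∀ {A : Set} {a : A} {as} → a ∈ a ∷ as
v0 = here refl

v1 : ∀ {A : Set} {a b : A} {as} → a ∈ b ∷ a ∷ as
v1 = there v0

v2 : ∀ {A : Set} {a b c : A} {as} → a ∈ b ∷ c ∷ a ∷ as
v2 = there v1

v3 : ∀ {A : Set} {a b c d : A} {as} → a ∈ b ∷ c ∷ d ∷ a ∷ as
v3 = there v2

module Model (L : LinOrder) where
  open LinOrder L public
  open Semantics L public
  open IsStrictTotalOrder isLinear public using (compare; irrefl; asym) renaming (trans to <-trans)
  open import Relation.Binary.Construct.StrictToNonStrict _≡_ _<_ public using (_≤_)

  <-irrefl : ∀ {a} → ¬ a < a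
  <-irrefl = irrefl refl

  ≤-<-trans : ∀ {a b c} → a ≤ b → b < c → a < c
  ≤-<-trans (inj₁ a<b) b<c = <-trans a<b b<c
  ≤-<-trans (inj₂ refl) b<c = b<c

  <-≤-trans : ∀ {a b c} → a < b → b ≤ c → a < c
  <-≤-trans a<b (inj₁ b<c) = <-trans a<b b<c
  <-≤-trans a<b (inj₂ refl) = a<b

  ≤⇒≯ : ∀ {a b} → a ≤ b → ¬ b < a
  ≤⇒≯ (inj₁ a<b) b<a = asym a<b b<a
  ≤⇒≯ (inj₂ refl) = <-irrefl

  st en : Interval → D
  st = proj₁ ∘ proj₁
  en = proj₂ ∘ proj₁

  holds : ∀ {S} → Formula S Γxy → D → D → Set
  holds φ x y = ⟦ φ ⟧ (x ∷ y ∷ [])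

  TwoAbove TwoBelow : D → Set
  TwoAbove y = ∃₂ λ d e → y < d × d < e
  TwoBelow x = ∃₂ λ c d → c < d × d < x

  commonStart⇒commonEnd : ∀ {y} → ¬ TwoAbove y →
    ∀ J K → y ≡ st J → y ≡ st K → en J ≡ en K
  commonStart⇒commonEnd ¬two ((_ , b) , y<b) ((_ , b′) , y<b′) refl refl with compare b b′
  ... | tri< b<b′ _ _ = ⊥-elim (¬two (b , b′ , y<b , b<b′))
  ... | tri≈ _ b≡b′ _ = b≡b′
  ... | tri> _ _ b′<b = ⊥-elim (¬two (b′ , b , y<b′ , b′<b))

  commonEnd⇒commonStart : ∀ {x} → ¬ TwoBelow x →
    ∀ J K → x ≡ en J → x ≡ en K → st J ≡ st K
  commonEnd⇒commonStart ¬two ((a , _) , a<x) ((a′ , _) , a′<x) refl refl with compare a a′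
  ... | tri< a<a′ _ _ = ⊥-elim (¬two (a , a′ , a<a′ , a′<x))
  ... | tri≈ _ a≡a′ _ = a≡a′
  ... | tri> _ _ a′<a = ⊥-elim (¬two (a′ , a , a′<a , a<x))

ltComplete : ∀ {S} (φ : Formula S Γxy) → Occurs zero φ → Occurs (suc zero) φ →
  (∀ L → let open Model L in ∀ {x y} → x < y → holds φ x y) →
  (∀ L → let open Model L in ∀ {x y} → holds φ x y → ¬ y ≤ x) →
  LtComplete S
ltComplete φ x∈φ y∈φ complete sound =
  φ , x∈φ , y∈φ , λ L x y → mk⇔ (φ⇒< L) (complete L)
  where
  φ⇒< : ∀ L → let open Model L in ∀ {x y} → holds φ x y → x < y
  φ⇒< L {x} {y} φxy with Model.compare L x y
  ... | tri< x<y _ _ = x<y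
  ... | tri≈ _ x≡y _ = ⊥-elim (sound L φxy (inj₂ (sym x≡y)))
  ... | tri> _ _ y<x = ⊥-elim (sound L φxy (inj₁ y<x))

ltComplete-¬ : ∀ {S} (ψ : Formula S Γxy) → Occurs zero ψ → Occurs (suc zero) ψ →
  (∀ L → let open Model L in ∀ {x y} → y ≤ x → holds ψ x y) →
  (∀ L → let open Model L in ∀ {x y} → x < y → ¬ holds ψ x y) →
  LtComplete S
ltComplete-¬ ψ x∈ψ y∈ψ ≤⇒ψ <⇒¬ψ =
  ltComplete (¬′ ψ) (neg x∈ψ) (neg y∈ψ) <⇒¬ψ (λ L ¬ψ y≤x → ¬ψ (≤⇒ψ L y≤x))

-- St is parametrised by the positions of its two point arguments; the first
-- hypothesis says that exchanging the positions exchanges the arguments, which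
-- holds definitionally for every concrete St.
ltComplete-strictPart : ∀ {S} (St : pt ∈ Γxy → pt ∈ Γxy → Formula S Γxy) →
  Occurs zero (St v0 v1) → Occurs (suc zero) (St v0 v1) →
  (∀ L → let open Model L in ∀ {u v} → holds (St v0 v1) v u → holds (St v1 v0) u v) →
  (∀ L → let open Model L in ∀ {u v} → u < v → holds (St v0 v1) u v) →
  (∀ L → let open Model L in ∀ {u v} → u < v → ¬ holds (St v1 v0) u v) →
  LtComplete S
ltComplete-strictPart St x∈St y∈St St-swap <⇒St <⇒¬St′ =
  ltComplete (St v0 v1 ∧′ (¬′ St v1 v0)) (andˡ x∈St) (andˡ y∈St)
    (λ L x<y → <⇒St L x<y , <⇒¬St′ L x<y) sound
  where
  sound : ∀ L → let open Model L in ∀ {x y} →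
    holds (St v0 v1 ∧′ (¬′ St v1 v0)) x y → ¬ y ≤ x
  sound L (_ , ¬St′) (inj₁ y<x) = ¬St′ (St-swap L (<⇒St L y<x))
  sound L (Stxx , ¬Stxx) (inj₂ refl) = ¬Stxx (St-swap L Stxx)

record CommonStartEquality (S : List Sym) : Set₁ where
  field
    formula : Formula S ΓKJxy
    holds-if-equal : ∀ L → let open Model L in ∀ {K J x y} →
      st J ≡ st K → en J ≡ en K → ⟦ formula ⟧ (K ∷ J ∷ x ∷ y ∷ [])
    refutes-longer : ∀ L → let open Model L in ∀ {K J x y} →
      st J ≡ st K → ⟦ formula ⟧ (K ∷ J ∷ x ∷ y ∷ []) → ¬ en J < en K

record CommonEndEquality (S : List Sym) : Set₁ where
  field
    formula : Formula S ΓKJxy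
    holds-if-equal : ∀ L → let open Model L in ∀ {K J x y} →
      en J ≡ en K → st J ≡ st K → ⟦ formula ⟧ (K ∷ J ∷ x ∷ y ∷ [])
    refutes-longer : ∀ L → let open Model L in ∀ {K J x y} →
      en J ≡ en K → ⟦ formula ⟧ (K ∷ J ∷ x ∷ y ∷ []) → ¬ st K < st J

record LtWithTwoAbove (S : List Sym) : Set₁ where
  field
    formula : Formula S Γxy
    complete : ∀ L → let open Model L in ∀ {x y} → x < y → TwoAbove y → holds formula x y
    sound : ∀ L → let open Model L in ∀ {x y} → holds formula x y → ¬ y ≤ x

record LtWithTwoBelow (S : List Sym) : Set₁ where
  field
    formula : Formula S Γxy
    complete : ∀ L → let open Model L in ∀ {x y} → x < y → TwoBelow x → holds formula x y
    sound : ∀ L → let open Model L in ∀ {x y} → holds formula x y → ¬ y ≤ x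

ltComplete-ip1 : ∀ {S} → ip1 ∈ S → CommonStartEquality S → LtWithTwoAbove S → LtComplete S
ltComplete-ip1 {S} ip1∈S eq lt = ltComplete-¬ (¬′ χ)
  (neg (orˡ (andʳ (ex (andˡ (atomʳ refl)))))) (neg (orˡ (andʳ (ex (andʳ (neg (atomʳ refl)))))))
  ≤⇒¬χ <⇒¬¬χ
  where
  module Eq = CommonStartEquality eq
  module Lt = LtWithTwoAbove lt

  fromY-unique fromX-notAtY χ : Formula S Γxy
  fromY-unique = ∀′ iv (∀′ iv (atom ip1 ip1∈S v1 v3 ⇒′ (atom ip1 ip1∈S v0 v3 ⇒′ Eq.formula)))
  fromX-notAtY = ∃′ iv (atom ip1 ip1∈S v0 v1 ∧′ (¬′ atom ip1 ip1∈S v0 v2))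
  χ = (fromY-unique ∧′ fromX-notAtY) ∨′ Lt.formula

  ≤⇒¬χ : ∀ L → let open Model L in ∀ {x y} → y ≤ x → ¬ holds χ x y
  ≤⇒¬χ L y≤x (inj₂ Lt-xy) = Lt.sound L Lt-xy y≤x
  ≤⇒¬χ L (inj₂ y≡x) (inj₁ (_ , _ , x≡a , y≢a)) = y≢a (trans y≡x x≡a)
  ≤⇒¬χ L (inj₁ y<x) (inj₁ (unique , (_ , x<b) , refl , _)) =
    Eq.refutes-longer L refl (unique (_ , y<x) (_ , Model.<-trans L y<x x<b) refl refl) x<b

  <⇒¬¬χ : ∀ L → let open Model L in ∀ {x y} → x < y → ¬ ¬ holds χ x y
  <⇒¬¬χ L {x} {y} x<y ¬χ = ¬¬-excluded-middle λ
    { (yes two) → ¬χ (inj₂ (Lt.complete L x<y two))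
    ; (no ¬two) → ¬χ (inj₁ (unique ¬two , (_ , x<y) , refl , λ y≡x → irrefl (sym y≡x) x<y)) }
    where
    open Model L
    unique : ¬ TwoAbove y → holds fromY-unique x y
    unique ¬two J K y≡stJ y≡stK =
      Eq.holds-if-equal L (trans (sym y≡stJ) y≡stK)
        (commonStart⇒commonEnd ¬two J K y≡stJ y≡stK)

ltComplete-ip3 : ∀ {S} → ip3 ∈ S → CommonEndEquality S → LtWithTwoBelow S → LtComplete S
ltComplete-ip3 {S} ip3∈S eq lt = ltComplete-¬ (¬′ χ)
  (neg (orˡ (andʳ (ex (andʳ (neg (atomʳ refl))))))) (neg (orˡ (andʳ (ex (andˡ (atomʳ refl))))))
  ≤⇒¬χ <⇒¬¬χ
  where
  module Eq = CommonEndEquality eq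
  module Lt = LtWithTwoBelow lt

  toX-unique toY-notAtX χ : Formula S Γxy
  toX-unique = ∀′ iv (∀′ iv (atom ip3 ip3∈S v1 v2 ⇒′ (atom ip3 ip3∈S v0 v2 ⇒′ Eq.formula)))
  toY-notAtX = ∃′ iv (atom ip3 ip3∈S v0 v2 ∧′ (¬′ atom ip3 ip3∈S v0 v1))
  χ = (toX-unique ∧′ toY-notAtX) ∨′ Lt.formula

  ≤⇒¬χ : ∀ L → let open Model L in ∀ {x y} → y ≤ x → ¬ holds χ x y
  ≤⇒¬χ L y≤x (inj₂ Lt-xy) = Lt.sound L Lt-xy y≤x
  ≤⇒¬χ L (inj₂ y≡x) (inj₁ (_ , _ , y≡b , x≢b)) = x≢b (trans (sym y≡x) y≡b)
  ≤⇒¬χ L (inj₁ y<x) (inj₁ (unique , (_ , a<y) , refl , _)) =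
    Eq.refutes-longer L refl (unique (_ , y<x) (_ , Model.<-trans L a<y y<x) refl refl) a<y

  <⇒¬¬χ : ∀ L → let open Model L in ∀ {x y} → x < y → ¬ ¬ holds χ x y
  <⇒¬¬χ L {x} {y} x<y ¬χ = ¬¬-excluded-middle λ
    { (yes two) → ¬χ (inj₂ (Lt.complete L x<y two))
    ; (no ¬two) → ¬χ (inj₁ (unique ¬two , (_ , x<y) , refl , λ x≡y → irrefl x≡y x<y)) }
    where
    open Model L
    unique : ¬ TwoBelow x → holds toX-unique x y
    unique ¬two J K x≡enJ x≡enK =
      Eq.holds-if-equal L (trans (sym x≡enJ) x≡enK)
        (commonEnd⇒commonStart ¬two J K x≡enJ x≡enK)

ltComplete-ip0-ip1 : LtComplete (ip0 ∷ ip1 ∷ [])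
ltComplete-ip0-ip1 =
  ltComplete φ (ex (andˡ (atomʳ refl))) (ex (andʳ (andˡ (neg (atomʳ refl)))))
    complete sound
  where
  φ : Formula (ip0 ∷ ip1 ∷ []) Γxy
  φ = ∃′ iv (atom ip1 v1 v0 v1 ∧′ ((¬′ atom ip0 v0 v0 v2) ∧′ (¬′ atom ip1 v1 v0 v2)))
  complete : ∀ L → let open Model L in ∀ {x y} → x < y → holds φ x y
  complete L x<y = (_ , x<y) , refl , Model.asym L x<y , λ y≡x → Model.irrefl L (sym y≡x) x<y
  sound : ∀ L → let open Model L in ∀ {x y} → holds φ x y → ¬ y ≤ x
  sound L (_ , refl , ¬y<x , _) (inj₁ y<x) = ¬y<x y<x
  sound L (_ , refl , _ , ¬y≡x) (inj₂ y≡x) = ¬y≡x y≡x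

ltComplete-ip3-ip4 : LtComplete (ip3 ∷ ip4 ∷ [])
ltComplete-ip3-ip4 =
  ltComplete φ (ex (andʳ (andˡ (neg (atomʳ refl))))) (ex (andˡ (atomʳ refl)))
    complete sound
  where
  φ : Formula (ip3 ∷ ip4 ∷ []) Γxy
  φ = ∃′ iv (atom ip3 v0 v0 v2 ∧′ ((¬′ atom ip3 v0 v0 v1) ∧′ (¬′ atom ip4 v1 v0 v1)))
  complete : ∀ L → let open Model L in ∀ {x y} → x < y → holds φ x y
  complete L x<y = (_ , x<y) , refl , (λ x≡y → Model.irrefl L x≡y x<y) , Model.asym L x<y
  sound : ∀ L → let open Model L in ∀ {x y} → holds φ x y → ¬ y ≤ x
  sound L (_ , refl , _ , ¬y<x) (inj₁ y<x) = ¬y<x y<x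
  sound L (_ , refl , ¬x≡y , _) (inj₂ y≡x) = ¬x≡y (sym y≡x)

ltComplete-ip1-ip3 : LtComplete (ip1 ∷ ip3 ∷ [])
ltComplete-ip1-ip3 =
  ltComplete φ (ex (andˡ (atomʳ refl))) (ex (andʳ (atomʳ refl)))
    complete sound
  where
  φ : Formula (ip1 ∷ ip3 ∷ []) Γxy
  φ = ∃′ iv (atom ip1 v0 v0 v1 ∧′ atom ip3 v1 v0 v2)
  complete : ∀ L → let open Model L in ∀ {x y} → x < y → holds φ x y
  complete L x<y = (_ , x<y) , refl , refl
  sound : ∀ L → let open Model L in ∀ {x y} → holds φ x y → ¬ y ≤ x
  sound L ((_ , x<y) , refl , refl) y≤x = Model.≤⇒≯ L y≤x x<y

ltComplete-ip0-ip3 : LtComplete (ip0 ∷ ip3 ∷ [])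
ltComplete-ip0-ip3 =
  ltComplete-¬ ψ (all (impʳ (ex (andˡ (atomʳ refl))))) (all (impˡ (atomʳ refl)))
    ≤⇒ψ <⇒¬ψ
  where
  ψ : Formula (ip0 ∷ ip3 ∷ []) Γxy
  ψ = ∀′ iv (atom ip3 v1 v0 v2 ⇒′ ∃′ iv (atom ip3 v1 v0 v2 ∧′
        ∀′ pt (atom ip0 v0 v2 v0 ⇒′ atom ip0 v0 v1 v0)))
  ≤⇒ψ : ∀ L → let open Model L in ∀ {x y} → y ≤ x → holds ψ x y
  ≤⇒ψ L y≤x ((a , _) , a<y) refl = (_ , Model.<-≤-trans L a<y y≤x) , refl , λ _ z<a → z<a
  <⇒¬ψ : ∀ L → let open Model L in ∀ {x y} → x < y → ¬ holds ψ x y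
  <⇒¬ψ L x<y ψxy with ψxy (_ , x<y) refl
  ... | ((c , _) , c<x) , refl , below-x⇒below-c = Model.<-irrefl L (below-x⇒below-c c c<x)

ltComplete-ip1-ip4 : LtComplete (ip1 ∷ ip4 ∷ [])
ltComplete-ip1-ip4 =
  ltComplete-¬ ψ (all (impˡ (atomʳ refl))) (all (impʳ (ex (andˡ (atomʳ refl)))))
    ≤⇒ψ <⇒¬ψ
  where
  ψ : Formula (ip1 ∷ ip4 ∷ []) Γxy
  ψ = ∀′ iv (atom ip1 v0 v0 v1 ⇒′ ∃′ iv (atom ip1 v0 v0 v3 ∧′
        ∀′ pt (atom ip4 v1 v2 v0 ⇒′ atom ip4 v1 v1 v0)))
  ≤⇒ψ : ∀ L → let open Model L in ∀ {x y} → y ≤ x → holds ψ x y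
  ≤⇒ψ L y≤x ((_ , b) , x<b) refl = (_ , Model.≤-<-trans L y≤x x<b) , refl , λ _ b<z → b<z
  <⇒¬ψ : ∀ L → let open Model L in ∀ {x y} → x < y → ¬ holds ψ x y
  <⇒¬ψ L x<y ψxy with ψxy (_ , x<y) refl
  ... | ((_ , d) , y<d) , refl , above-y⇒above-d = Model.<-irrefl L (above-y⇒above-d d y<d)

ltComplete-ip1-ip2 : LtComplete (ip1 ∷ ip2 ∷ [])
ltComplete-ip1-ip2 =
  ltComplete-¬ ψ (all (impˡ (atomʳ refl))) (all (impʳ (ex (andˡ (atomʳ refl)))))
    ≤⇒ψ <⇒¬ψ
  where
  ψ : Formula (ip1 ∷ ip2 ∷ []) Γxy
  ψ = ∀′ iv (atom ip1 v0 v0 v1 ⇒′ ∃′ iv (atom ip1 v0 v0 v3 ∧′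
        ∀′ pt ((atom ip1 v0 v2 v0 ∨′ atom ip2 v1 v2 v0) ⇒′ (atom ip1 v0 v1 v0 ∨′ atom ip2 v1 v1 v0))))
  ≤⇒ψ : ∀ L → let open Model L in ∀ {x y} → y ≤ x → holds ψ x y
  ≤⇒ψ L {x} {y} y≤x ((_ , b) , x<b) refl = (_ , ≤-<-trans y≤x x<b) , refl , inclusion y≤x
    where
    open Model L
    inclusion : y ≤ x → ∀ z → z ≡ x ⊎ (x < z × z < b) → z ≡ y ⊎ (y < z × z < b)
    inclusion (inj₁ y<x) _ (inj₁ refl) = inj₂ (y<x , x<b)
    inclusion (inj₂ refl) _ (inj₁ refl) = inj₁ refl
    inclusion y≤x _ (inj₂ (x<z , z<b)) = inj₂ (≤-<-trans y≤x x<z , z<b)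
  <⇒¬ψ : ∀ L → let open Model L in ∀ {x y} → x < y → ¬ holds ψ x y
  <⇒¬ψ L {x} x<y ψxy with ψxy (_ , x<y) refl
  ... | _ , refl , inclusion with inclusion x (inj₁ refl)
  ...   | inj₁ x≡y = Model.irrefl L x≡y x<y
  ...   | inj₂ (y<x , _) = Model.asym L y<x x<y

ltComplete-ip2-ip3 : LtComplete (ip2 ∷ ip3 ∷ [])
ltComplete-ip2-ip3 =
  ltComplete-¬ ψ (all (impʳ (ex (andˡ (atomʳ refl))))) (all (impˡ (atomʳ refl)))
    ≤⇒ψ <⇒¬ψ
  where
  ψ : Formula (ip2 ∷ ip3 ∷ []) Γxy
  ψ = ∀′ iv (atom ip3 v1 v0 v2 ⇒′ ∃′ iv (atom ip3 v1 v0 v2 ∧′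
        ∀′ pt ((atom ip2 v0 v2 v0 ∨′ atom ip3 v1 v2 v0) ⇒′ (atom ip2 v0 v1 v0 ∨′ atom ip3 v1 v1 v0))))
  ≤⇒ψ : ∀ L → let open Model L in ∀ {x y} → y ≤ x → holds ψ x y
  ≤⇒ψ L {x} {y} y≤x ((a , _) , a<y) refl = (_ , <-≤-trans a<y y≤x) , refl , inclusion y≤x
    where
    open Model L
    inclusion : y ≤ x → ∀ z → (a < z × z < y) ⊎ z ≡ y → (a < z × z < x) ⊎ z ≡ x
    inclusion y≤x _ (inj₁ (a<z , z<y)) = inj₁ (a<z , <-≤-trans z<y y≤x)
    inclusion (inj₁ y<x) _ (inj₂ refl) = inj₁ (a<y , y<x)
    inclusion (inj₂ refl) _ (inj₂ refl) = inj₂ refl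
  <⇒¬ψ : ∀ L → let open Model L in ∀ {x y} → x < y → ¬ holds ψ x y
  <⇒¬ψ L {y = y} x<y ψxy with ψxy (_ , x<y) refl
  ... | _ , refl , inclusion with inclusion y (inj₂ refl)
  ...   | inj₁ (_ , y<x) = Model.asym L y<x x<y
  ...   | inj₂ y≡x = Model.irrefl L (sym y≡x) x<y

ltComplete-ip1-ii03 : LtComplete (ip1 ∷ ii03 ∷ [])
ltComplete-ip1-ii03 = ltComplete-strictPart St
  (all (impʳ (ex (andˡ (atomʳ refl))))) (all (impˡ (atomʳ refl))) (λ _ St → St) <⇒St <⇒¬St′
  where
  St : pt ∈ Γxy → pt ∈ Γxy → Formula (ip1 ∷ ii03 ∷ []) Γxy
  St u v = ∀′ iv (atom ip1 v0 v0 (there v) ⇒′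
    ∃′ iv (atom ip1 v0 v0 (there (there u)) ∧′ atom ii03 v1 v1 v0))
  <⇒St : ∀ L → let open Model L in ∀ {u v} → u < v → holds (St v0 v1) u v
  <⇒St L u<v (_ , v<b) refl = (_ , Model.<-trans L u<v v<b) , refl , u<v , refl
  <⇒¬St′ : ∀ L → let open Model L in ∀ {u v} → u < v → ¬ holds (St v1 v0) u v
  <⇒¬St′ L u<v St′ with St′ (_ , u<v) refl
  ... | _ , refl , v<u , _ = Model.asym L v<u u<v

ltComplete-ip3-ii14 : LtComplete (ip3 ∷ ii14 ∷ [])
ltComplete-ip3-ii14 = ltComplete-strictPart St
  (all (impˡ (atomʳ refl))) (all (impʳ (ex (andˡ (atomʳ refl))))) (λ _ St → St) <⇒St <⇒¬St′
  where
  St : pt ∈ Γxy → pt ∈ Γxy → Formula (ip3 ∷ ii14 ∷ []) Γxy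
  St u v = ∀′ iv (atom ip3 v0 v0 (there u) ⇒′
    ∃′ iv (atom ip3 v0 v0 (there (there v)) ∧′ atom ii14 v1 v1 v0))
  <⇒St : ∀ L → let open Model L in ∀ {u v} → u < v → holds (St v0 v1) u v
  <⇒St L u<v (_ , a<u) refl = (_ , Model.<-trans L a<u u<v) , refl , refl , u<v
  <⇒¬St′ : ∀ L → let open Model L in ∀ {u v} → u < v → ¬ holds (St v1 v0) u v
  <⇒¬St′ L u<v St′ with St′ (_ , u<v) refl
  ... | (_ , u<u) , refl , refl , _ = Model.<-irrefl L u<u

ltComplete-ip1-ii34 : LtComplete (ip1 ∷ ii34 ∷ [])
ltComplete-ip1-ii34 = ltComplete-strictPart St
  (all (impʳ (ex (andˡ (atomʳ refl))))) (all (impˡ (atomʳ refl))) (λ _ St → St) <⇒St <⇒¬St′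
  where
  St : pt ∈ Γxy → pt ∈ Γxy → Formula (ip1 ∷ ii34 ∷ []) Γxy
  St u v = ∀′ iv (atom ip1 v0 v0 (there v) ⇒′
    ∃′ iv (atom ip1 v0 v0 (there (there u)) ∧′ atom ii34 v1 v0 v1))
  <⇒St : ∀ L → let open Model L in ∀ {u v} → u < v → holds (St v0 v1) u v
  <⇒St L u<v (_ , v<b) refl = (_ , u<v) , refl , refl , v<b
  <⇒¬St′ : ∀ L → let open Model L in ∀ {u v} → u < v → ¬ holds (St v1 v0) u v
  <⇒¬St′ L u<v St′ with St′ (_ , u<v) refl
  ... | (_ , v<u) , refl , refl , _ = Model.asym L v<u u<v

ltComplete-ip3-ii34 : LtComplete (ip3 ∷ ii34 ∷ [])
ltComplete-ip3-ii34 = ltComplete-strictPart St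
  (all (impˡ (atomʳ refl))) (all (impʳ (ex (andˡ (atomʳ refl))))) (λ _ St → St) <⇒St <⇒¬St′
  where
  St : pt ∈ Γxy → pt ∈ Γxy → Formula (ip3 ∷ ii34 ∷ []) Γxy
  St u v = ∀′ iv (atom ip3 v0 v0 (there u) ⇒′
    ∃′ iv (atom ip3 v0 v0 (there (there v)) ∧′ atom ii34 v1 v1 v0))
  <⇒St : ∀ L → let open Model L in ∀ {u v} → u < v → holds (St v0 v1) u v
  <⇒St L u<v _ refl = (_ , u<v) , refl , refl , u<v
  <⇒¬St′ : ∀ L → let open Model L in ∀ {u v} → u < v → ¬ holds (St v1 v0) u v
  <⇒¬St′ L u<v St′ with St′ (_ , u<v) refl
  ... | (_ , v<u) , refl , refl , _ = Model.asym L v<u u<v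

eqi-commonStartEquality : ∀ {S} → eqi ∈ S → CommonStartEquality S
eqi-commonStartEquality eqi∈S = record
  { formula = atom eqi eqi∈S v1 v0
  ; holds-if-equal = λ _ st≡ en≡ → st≡ , en≡
  ; refutes-longer = λ L _ (_ , en≡) → Model.irrefl L en≡
  }

¬ii14-commonStartEquality : ∀ {S} → ii14 ∈ S → CommonStartEquality S
¬ii14-commonStartEquality ii14∈S = record
  { formula = ¬′ atom ii14 ii14∈S v1 v0
  ; holds-if-equal = λ L _ en≡ (_ , enJ<enK) → Model.irrefl L en≡ enJ<enK
  ; refutes-longer = λ _ st≡ ¬ii14 enJ<enK → ¬ii14 (sym st≡ , enJ<enK)
  }

eqi-commonEndEquality : ∀ {S} → eqi ∈ S → CommonEndEquality S
eqi-commonEndEquality eqi∈S = record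
  { formula = atom eqi eqi∈S v1 v0
  ; holds-if-equal = λ _ en≡ st≡ → st≡ , en≡
  ; refutes-longer = λ L _ (st≡ , _) → Model.irrefl L (sym st≡)
  }

¬ii03-commonEndEquality : ∀ {S} → ii03 ∈ S → CommonEndEquality S
¬ii03-commonEndEquality ii03∈S = record
  { formula = ¬′ atom ii03 ii03∈S v1 v0
  ; holds-if-equal = λ L _ st≡ (stK<stJ , _) → Model.irrefl L (sym st≡) stK<stJ
  ; refutes-longer = λ _ en≡ ¬ii03 stK<stJ → ¬ii03 (stK<stJ , sym en≡)
  }

ii04-ltWithTwoAbove : ∀ {S} → ip1 ∈ S → ii04 ∈ S → LtWithTwoAbove S
ii04-ltWithTwoAbove ip1∈S ii04∈S = record
  { formula =
      ∃′ iv (∃′ iv (atom ip1 ip1∈S v1 v2 ∧′ (atom ip1 ip1∈S v0 v3 ∧′ atom ii04 ii04∈S v0 v1)))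
  ; complete = λ L x<y (_ , _ , y<d , d<e) → let open Model L in
      (_ , <-trans x<y (<-trans y<d d<e)) , (_ , y<d) , refl , refl , x<y , d<e
  ; sound = λ { L (_ , _ , refl , refl , x<y , _) y≤x → Model.≤⇒≯ L y≤x x<y }
  }

ii24-ltWithTwoAbove : ∀ {S} → ip1 ∈ S → ii24 ∈ S → LtWithTwoAbove S
ii24-ltWithTwoAbove ip1∈S ii24∈S = record
  { formula =
      ∃′ iv (∃′ iv (atom ip1 ip1∈S v1 v2 ∧′ (atom ip1 ip1∈S v0 v3 ∧′ atom ii24 ii24∈S v1 v0)))
  ; complete = λ L x<y (_ , _ , y<d , d<e) → let open Model L in
      (_ , <-trans x<y y<d) , (_ , <-trans y<d d<e) , refl , refl , (x<y , y<d) , d<e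
  ; sound = λ { L (_ , _ , refl , refl , (x<y , _) , _) y≤x → Model.≤⇒≯ L y≤x x<y }
  }

ii04-ltWithTwoBelow : ∀ {S} → ip3 ∈ S → ii04 ∈ S → LtWithTwoBelow S
ii04-ltWithTwoBelow ip3∈S ii04∈S = record
  { formula =
      ∃′ iv (∃′ iv (atom ip3 ip3∈S v1 v3 ∧′ (atom ip3 ip3∈S v0 v2 ∧′ atom ii04 ii04∈S v0 v1)))
  ; complete = λ L x<y (_ , _ , c<d , d<x) → let open Model L in
      (_ , <-trans c<d (<-trans d<x x<y)) , (_ , d<x) , refl , refl , c<d , x<y
  ; sound = λ { L (_ , _ , refl , refl , _ , x<y) y≤x → Model.≤⇒≯ L y≤x x<y }
  }

ii24-ltWithTwoBelow : ∀ {S} → ip3 ∈ S → ii24 ∈ S → LtWithTwoBelow S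
ii24-ltWithTwoBelow ip3∈S ii24∈S = record
  { formula =
      ∃′ iv (∃′ iv (atom ip3 ip3∈S v1 v3 ∧′ (atom ip3 ip3∈S v0 v2 ∧′ atom ii24 ii24∈S v0 v1)))
  ; complete = λ L x<y (_ , _ , c<d , d<x) → let open Model L in
      (_ , <-trans d<x x<y) , (_ , <-trans c<d d<x) , refl , refl , (c<d , d<x) , x<y
  ; sound = λ { L (_ , _ , refl , refl , _ , x<y) y≤x → Model.≤⇒≯ L y≤x x<y }
  }

ii44-ltWithTwoAbove : ∀ {S} → ip1 ∈ S → ii44 ∈ S → LtWithTwoAbove S
ii44-ltWithTwoAbove {S} ip1∈S ii44∈S = record { formula = φ ; complete = complete ; sound = sound }
  where
  φ : Formula S Γxy
  φ = ∃′ iv (atom ip1 ip1∈S v0 v1 ∧′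
        ∀′ iv (atom ip1 ip1∈S v0 v3 ⇒′
          ∃′ iv (atom ii44 ii44∈S v2 v0 ∧′ (¬′ atom ii44 ii44∈S v1 v0))))
  complete : ∀ L → let open Model L in ∀ {x y} → x < y → TwoAbove y → holds φ x y
  complete L {y = y} x<y (d , e , y<d , d<e) = (_ , x<y) , refl , escape
    where
    open Model L
    escape : ∀ J → y ≡ st J → ∃ λ K → (y < st K × y < en K) × ¬ (en J < st K × en J < en K)
    escape ((_ , b) , y<b) refl with compare b d
    ... | tri< b<d _ _ = (_ , b<d) , (y<b , y<d) , <-irrefl ∘ proj₁
    ... | tri≈ _ refl _ = (_ , d<e) , (y<d , <-trans y<d d<e) , <-irrefl ∘ proj₁
    ... | tri> _ _ d<b = (_ , d<e) , (y<d , <-trans y<d d<e) , λ (b<d , _) → asym b<d d<b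
  sound : ∀ L → let open Model L in ∀ {x y} → holds φ x y → ¬ y ≤ x
  sound L ((_ , x<b) , refl , escape) (inj₁ y<x) with escape (_ , y<x) refl
  ... | _ , (b<c , b<d) , ¬after = ¬after (Model.<-trans L x<b b<c , Model.<-trans L x<b b<d)
  sound L (I , refl , escape) (inj₂ refl) with escape I refl
  ... | _ , after , ¬after = ¬after after

ii44-ltWithTwoBelow : ∀ {S} → ip3 ∈ S → ii44 ∈ S → LtWithTwoBelow S
ii44-ltWithTwoBelow {S} ip3∈S ii44∈S = record { formula = φ ; complete = complete ; sound = sound }
  where
  φ : Formula S Γxy
  φ = ∃′ iv (atom ip3 ip3∈S v0 v2 ∧′
        ∀′ iv (atom ip3 ip3∈S v0 v2 ⇒′
          ∃′ iv (atom ii44 ii44∈S v0 v2 ∧′ (¬′ atom ii44 ii44∈S v0 v1))))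
  complete : ∀ L → let open Model L in ∀ {x y} → x < y → TwoBelow x → holds φ x y
  complete L {x} {y} x<y (c , d , c<d , d<x) = (_ , x<y) , refl , escape
    where
    open Model L
    escape : ∀ J → x ≡ en J → ∃ λ K → (en K < x × en K < y) × ¬ (en K < st J × en K < en J)
    escape ((a , _) , a<x) refl with compare d a
    ... | tri< d<a _ _ = (_ , d<a) , (a<x , <-trans a<x x<y) , <-irrefl ∘ proj₁
    ... | tri≈ _ refl _ = (_ , c<d) , (d<x , <-trans d<x x<y) , <-irrefl ∘ proj₁
    ... | tri> _ _ a<d = (_ , c<d) , (d<x , <-trans d<x x<y) , λ (d<a , _) → asym a<d d<a
  sound : ∀ L → let open Model L in ∀ {x y} → holds φ x y → ¬ y ≤ x
  sound L ((_ , a<y) , refl , escape) (inj₁ y<x) with escape (_ , y<x) refl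
  ... | _ , (c<a , c<y) , ¬before = ¬before (Model.<-trans L c<a a<y , Model.<-trans L c<y y<x)
  sound L (I , refl , escape) (inj₂ refl) with escape I refl
  ... | _ , before , ¬before = ¬before before

lemma3p5 : All LtComplete
    ( (ip0 ∷ ip1 ∷ [])
    ∷ (ip3 ∷ ip4 ∷ [])
    ∷ (ip0 ∷ ip3 ∷ [])
    ∷ (ip1 ∷ ip4 ∷ [])
    ∷ (ip1 ∷ ip2 ∷ [])
    ∷ (ip2 ∷ ip3 ∷ [])
    ∷ (ip1 ∷ ip3 ∷ [])
    ∷ (ip1 ∷ ii03 ∷ [])
    ∷ (ip3 ∷ ii14 ∷ [])
    ∷ (ip1 ∷ ii34 ∷ [])
    ∷ (ip3 ∷ ii34 ∷ [])
    ∷ (ip1 ∷ ii04 ∷ eqi ∷ [])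
    ∷ (ip3 ∷ ii04 ∷ eqi ∷ [])
    ∷ (ip1 ∷ ii24 ∷ eqi ∷ [])
    ∷ (ip3 ∷ ii24 ∷ eqi ∷ [])
    ∷ (ip1 ∷ ii44 ∷ eqi ∷ [])
    ∷ (ip3 ∷ ii44 ∷ eqi ∷ [])
    ∷ (ip1 ∷ ii14 ∷ ii24 ∷ [])
    ∷ (ip1 ∷ ii14 ∷ ii04 ∷ [])
    ∷ (ip1 ∷ ii14 ∷ ii44 ∷ [])
    ∷ (ip3 ∷ ii24 ∷ ii03 ∷ [])
    ∷ (ip3 ∷ ii03 ∷ ii04 ∷ [])
    ∷ (ip3 ∷ ii03 ∷ ii44 ∷ [])
    ∷ [] )
lemma3p5 =
    ltComplete-ip0-ip1 ∷ ltComplete-ip3-ip4 ∷ ltComplete-ip0-ip3 ∷ ltComplete-ip1-ip4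
  ∷ ltComplete-ip1-ip2 ∷ ltComplete-ip2-ip3 ∷ ltComplete-ip1-ip3
  ∷ ltComplete-ip1-ii03 ∷ ltComplete-ip3-ii14 ∷ ltComplete-ip1-ii34 ∷ ltComplete-ip3-ii34
  ∷ ltComplete-ip1 v0 (eqi-commonStartEquality v2) (ii04-ltWithTwoAbove v0 v1)
  ∷ ltComplete-ip3 v0 (eqi-commonEndEquality v2) (ii04-ltWithTwoBelow v0 v1)
  ∷ ltComplete-ip1 v0 (eqi-commonStartEquality v2) (ii24-ltWithTwoAbove v0 v1)
  ∷ ltComplete-ip3 v0 (eqi-commonEndEquality v2) (ii24-ltWithTwoBelow v0 v1)
  ∷ ltComplete-ip1 v0 (eqi-commonStartEquality v2) (ii44-ltWithTwoAbove v0 v1)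
  ∷ ltComplete-ip3 v0 (eqi-commonEndEquality v2) (ii44-ltWithTwoBelow v0 v1)
  ∷ ltComplete-ip1 v0 (¬ii14-commonStartEquality v1) (ii24-ltWithTwoAbove v0 v2)
  ∷ ltComplete-ip1 v0 (¬ii14-commonStartEquality v1) (ii04-ltWithTwoAbove v0 v2)
  ∷ ltComplete-ip1 v0 (¬ii14-commonStartEquality v1) (ii44-ltWithTwoAbove v0 v2)
  ∷ ltComplete-ip3 v0 (¬ii03-commonEndEquality v2) (ii24-ltWithTwoBelow v0 v1)
  ∷ ltComplete-ip3 v0 (¬ii03-commonEndEquality v1) (ii04-ltWithTwoBelow v0 v2)
  ∷ ltComplete-ip3 v0 (¬ii03-commonEndEquality v1) (ii44-ltWithTwoBelow v0 v2)
  ∷ []
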